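{- With respect to a triples table $T$, if $A_m$ and $A_k$ are distinct Independent Ancestor Sets, then $A_m\cap A_k=\emptyset$.
   Context: Non-free products of a Boolean function $f$ (products in the consensus closure of all primes that are not in the consensus closure of the Essential primes) are indexed $X_1,X_2,\dots$. The triples table $T$ is a set of index triples $(r,i,j)$, $j\ge 0$, encoding covering relationships between non-free products (index 0 standing for a free product). For $(r,i,0)\in T$, $i$ is a parent of $r$; for $(r,i,j)\in T$, $j>0$, $i$ and $j$ are parents of $r$. $Anc(r)$ is the set of parents of $r$, parents of parents, etc., iterated until nothing new is added; an Ancestor Set is a set of this form. An Ancestor Set is Independent if it does not properly contain any other Ancestor Set. -}

module Defs where

open import Data.Nat using (ℕ; zero; suc; _≤_; _<_)
open import Data.Product using (_×_; _,_; ∃-syntax)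
open import Data.List using (List)
open import Data.List.Membership.Propositional using (_∈_)
open import Data.List.Relation.Unary.All using (All)
open import Relation.Unary using (Pred; _≐_; _⊂_)
open import Relation.Binary.PropositionalEquality using (_≡_)
open import Level using (0ℓ)

-- A triple (r , i , j) of the triples table: r is covered by i and j
-- (j = 0 meaning a free product).
Triple : Set
Triple = ℕ × ℕ × ℕ

Table : Set
Table = List Triple

WFTriple : ℕ → Triple → Set
WFTriple n (r , i , j) = (1 ≤ r × r ≤ n) × (1 ≤ i × i ≤ n) × j ≤ n

WellFormed : ℕ → Table → Set
WellFormed n T = All (WFTriple n) T

data Parent (T : Table) : ℕ → ℕ → Set where
  par-left  : ∀ {r i j} → (r , i , j) ∈ T → Parent T i r
  par-right : ∀ {r i j} → (r , i , j) ∈ T → 0 < j → Parent T j r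

data Anc (T : Table) (r : ℕ) : ℕ → Set where
  anc-parent : ∀ {x} → Parent T x r → Anc T r x
  anc-step   : ∀ {x y} → Anc T r y → Parent T x y → Anc T r x

IsAncestorSet : ℕ → Table → Pred ℕ 0ℓ → Set
IsAncestorSet n T S = ∃[ r ] ((1 ≤ r × r ≤ n) × (S ≐ Anc T r))

Independent : ℕ → Table → Pred ℕ 0ℓ → Set₁
Independent n T S =
  IsAncestorSet n T S × (∀ (S′ : Pred ℕ 0ℓ) → IsAncestorSet n T S′ → ¬ (S′ ⊂ S))
  where open import Relation.Nullary using (¬_)

-- Ancestry is transitive, so an Ancestor Set contains Anc(x) for each of its
-- members x, and Anc(x) is itself an Ancestor Set. An Independent set cannot
-- properly contain it, so it lies inside Anc(x) as well; two Independent sets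
-- sharing x would therefore both coincide with Anc(x).
module Submission where

open import Defs
open import Data.Nat using (ℕ; _≤_)
open import Data.Product using (_×_; _,_)
open import Data.List.Relation.Unary.All using (lookup)
open import Relation.Unary using (Pred; _≐_; _∩_; Empty; _⊆_)
open import Relation.Unary.Properties using (≐-refl)
open import Relation.Nullary using (¬_)
open import Level using (0ℓ)

parent-nonFree : ∀ {n T x y} → WellFormed n T → Parent T x y → 1 ≤ x × x ≤ n
parent-nonFree wf (par-left r∈T) with lookup wf r∈T
... | _ , 1≤i×i≤n , _ = 1≤i×i≤n
parent-nonFree wf (par-right r∈T 0<j) with lookup wf r∈T
... | _ , _ , j≤n = 0<j , j≤n

anc-nonFree : ∀ {n T r x} → WellFormed n T → Anc T r x → 1 ≤ x × x ≤ n
anc-nonFree wf (anc-parent p) = parent-nonFree wf p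
anc-nonFree wf (anc-step _ p) = parent-nonFree wf p

anc-trans : ∀ {T r x y} → Anc T r x → Anc T x y → Anc T r y
anc-trans r→x (anc-parent p)   = anc-step r→x p
anc-trans r→x (anc-step x→z p) = anc-step (anc-trans r→x x→z) p

anc-isAncestorSet : ∀ {n T S x} → WellFormed n T → IsAncestorSet n T S → S x →
                    IsAncestorSet n T (Anc T x)
anc-isAncestorSet wf (_ , _ , S⊆Anc , _) x∈S =
  _ , anc-nonFree wf (S⊆Anc x∈S) , ≐-refl

anc⊆ancestorSet : ∀ {n T S x} → IsAncestorSet n T S → S x → Anc T x ⊆ S
anc⊆ancestorSet (_ , _ , S⊆Anc , Anc⊆S) x∈S x→y =
  Anc⊆S (anc-trans (S⊆Anc x∈S) x→y)

-- Minimality only refutes S ⊈ Anc(x), so constructively the inclusion is doubly negated.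
independent⊆anc : ∀ {n T S x} → WellFormed n T → Independent n T S → S x →
                  ¬ ¬ (S ⊆ Anc T x)
independent⊆anc wf (isS , minimal) x∈S S⊈Anc =
  minimal _ (anc-isAncestorSet wf isS x∈S) (anc⊆ancestorSet isS x∈S , S⊈Anc)

lemma4p7 : (n : ℕ) (T : Table) → WellFormed n T →
    (Am Ak : Pred ℕ 0ℓ) → Independent n T Am → Independent n T Ak →
    ¬ (Am ≐ Ak) → Empty (Am ∩ Ak)
lemma4p7 n T wf Am Ak indM@(isM , _) indK@(isK , _) Am≠Ak x (x∈Am , x∈Ak) =
  independent⊆anc wf indM x∈Am λ Am⊆Anc →
  independent⊆anc wf indK x∈Ak λ Ak⊆Anc →
  Am≠Ak ( (λ y∈Am → anc⊆ancestorSet isK x∈Ak (Am⊆Anc y∈Am))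
        , (λ y∈Ak → anc⊆ancestorSet isM x∈Am (Ak⊆Anc y∈Ak)))
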